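{- There is a function $F$ such that for every digraph $G$ and distinct vertices $u,v$ of $G$, if $P$ is the digraph obtained from $G$ by deleting all arcs (if any) joining $u$ and $v$, and $T\subseteq\{uv,vu\}$ is the set of arcs joining $u$ and $v$ in $G$ (recorded as one of the four possibilities $\emptyset$, $\{uv\}$, $\{vu\}$, $\{uv,vu\}$ relative to the ordered pair $(u,v)$), then $$(\mathrm{dt}_P(u),\mathrm{dt}_P(v),\mathrm{ndq}_P(u),\mathrm{ndq}_P(v))=F\big(T,\mathrm{dt}_G(u),\mathrm{dt}_G(v),\mathrm{ndq}_G(u),\mathrm{ndq}_G(v)\big).$$ That is, when the arcs joining $u$ and $v$ in $G$ are known, $\mathrm{dt}_P(u),\mathrm{dt}_P(v),\mathrm{ndq}_P(u),\mathrm{ndq}_P(v)$ are determined by $\mathrm{dt}_G(u),\mathrm{dt}_G(v),\mathrm{ndq}_G(u),\mathrm{ndq}_G(v)$.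
   Context: Digraphs are finite, without loops or multiple arcs. For vertices $x\neq w$: $w$ is an out-neighbor of $x$ if $xw$ is an arc and $wx$ is not; an in-neighbor if $wx$ is an arc and $xw$ is not; a strong neighbor if both are arcs. If $x$ has $a$ out-, $b$ in- and $c$ strong neighbors, $\mathrm{dt}(x)=(a,b,c)$, and $a,b,c,a+c,b+c$ are the first, second, third degree, outdegree, indegree of $x$. $\mathrm{ndq}(x)=(\mathrm{csdon}(x),\mathrm{cidon}(x),\mathrm{cfdin}(x),\mathrm{codin}(x),\mathrm{ctdsn}(x))$ where these are the multisets of, respectively: second degrees of out-neighbors of $x$; indegrees of out-neighbors of $x$; first degrees of in-neighbors of $x$; outdegrees of in-neighbors of $x$; third degrees of strong neighbors of $x$ (degrees computed in the digraph in question). -}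

module Defs where

open import Data.Bool using (Bool; true; false; _∧_; _∨_; not; if_then_else_)
open import Data.Nat using (ℕ; _+_)
import Data.Nat.Properties as ℕₚ
open import Data.Fin using (Fin; _≟_)
open import Data.List using (List; []; _∷_; map; length; filterᵇ; allFin)
open import Data.List.Sort.MergeSort ℕₚ.≤-decTotalOrder using (sort)
open import Data.Product using (_×_; _,_)
open import Relation.Nullary.Decidable using (⌊_⌋)
open import Relation.Binary.PropositionalEquality using (_≡_; refl)

record Digraph : Set where
  field
    n        : ℕ
    arc      : Fin n → Fin n → Bool
    loopless : ∀ x → arc x x ≡ false
open Digraph public

Vertex : Digraph → Set
Vertex G = Fin (n G)

isOut isIn isStrong : (G : Digraph) → Vertex G → Vertex G → Bool
isOut G x w = arc G x w ∧ not (arc G w x)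
isIn G x w = arc G w x ∧ not (arc G x w)
isStrong G x w = arc G x w ∧ arc G w x

outN inN strongN : (G : Digraph) → Vertex G → List (Vertex G)
outN G x = filterᵇ (isOut G x) (allFin (n G))
inN G x = filterᵇ (isIn G x) (allFin (n G))
strongN G x = filterᵇ (isStrong G x) (allFin (n G))

DT : Set
DT = ℕ × ℕ × ℕ

dt : (G : Digraph) → Vertex G → DT
dt G x = length (outN G x) , length (inN G x) , length (strongN G x)

firstDeg secondDeg thirdDeg outDeg inDeg : DT → ℕ
firstDeg (a , b , c) = a
secondDeg (a , b , c) = b
thirdDeg (a , b , c) = c
outDeg (a , b , c) = a + c
inDeg (a , b , c) = b + c

-- finite multisets of naturals, represented canonically as sorted lists
Multiset : Set
Multiset = List ℕ

multiset : List ℕ → Multiset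
multiset = sort

NDQ : Set
NDQ = Multiset × Multiset × Multiset × Multiset × Multiset

csdon cidon cfdin codin ctdsn : (G : Digraph) → Vertex G → Multiset
csdon G x = multiset (map (λ w → secondDeg (dt G w)) (outN G x))
cidon G x = multiset (map (λ w → inDeg (dt G w)) (outN G x))
cfdin G x = multiset (map (λ w → firstDeg (dt G w)) (inN G x))
codin G x = multiset (map (λ w → outDeg (dt G w)) (inN G x))
ctdsn G x = multiset (map (λ w → thirdDeg (dt G w)) (strongN G x))

ndq : (G : Digraph) → Vertex G → NDQ
ndq G x = csdon G x , cidon G x , cfdin G x , codin G x , ctdsn G x

data ArcSet : Set where
  noArc onlyUV onlyVU bothArcs : ArcSet

arcsBetween : (G : Digraph) → Vertex G → Vertex G → ArcSet
arcsBetween G u v with arc G u v | arc G v u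
... | false | false = noArc
... | true  | false = onlyUV
... | false | true  = onlyVU
... | true  | true  = bothArcs

private
  isPair : ∀ {m} → Fin m → Fin m → Fin m → Fin m → Bool
  isPair u v x y = (⌊ x ≟ u ⌋ ∧ ⌊ y ≟ v ⌋) ∨ (⌊ x ≟ v ⌋ ∧ ⌊ y ≟ u ⌋)

  delArc : (G : Digraph) → Vertex G → Vertex G → Vertex G → Vertex G → Bool
  delArc G u v x y = arc G x y ∧ not (isPair u v x y)

  delLoopless : (G : Digraph) (u v : Vertex G) → ∀ x → delArc G u v x x ≡ false
  delLoopless G u v x with arc G x x | loopless G x
  ... | false | refl = refl

deleteArcs : (G : Digraph) → Vertex G → Vertex G → Digraph
deleteArcs G u v = record
  { n = n G
  ; arc = delArc G u v
  ; loopless = delLoopless G u v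
  }

-- Deleting the arcs joining u and v changes no arc at a vertex w ∉ {u, v}, so
-- every such w keeps its degree triple. At u the only neighbour lost is v, and T
-- says in which of the three neighbourhoods v was: that coordinate of dt(u) drops
-- by one, and the multisets of ndq(u) built from that neighbourhood lose exactly
-- the entry contributed by v, which is a degree of v in G. All remaining entries
-- are degrees of vertices outside {u, v}, hence unchanged. Symmetrically at v.
module Submission where

open import Defs
open import Data.Bool using (Bool; true; false; _∧_; not; T?)
import Data.Bool as Bool
open import Data.Bool.Properties using (∧-zeroʳ; ∧-identityʳ; ∨-zeroʳ; T-≡; not-¬)
open import Function.Bundles using (Equivalence)
open import Data.Empty using (⊥-elim)
open import Data.Fin using (Fin; _≟_)
open import Data.List using (List; []; _∷_; map; length; filterᵇ; allFin)
open import Data.List.Properties using (map-cong-local)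
open import Data.List.Membership.Propositional using (_∈_)
open import Data.List.Membership.Propositional.Properties using (∈-allFin)
open import Data.List.Relation.Unary.All as All using (All; []; _∷_)
open import Data.List.Relation.Unary.All.Properties using (all-filter)
open import Data.List.Relation.Unary.Any using (here; there)
open import Data.List.Relation.Unary.Unique.Propositional using (Unique; []; _∷_)
open import Data.List.Relation.Unary.Unique.Propositional.Properties using (allFin⁺)
open import Data.List.Relation.Binary.Permutation.Propositional
  using (_↭_; prep; swap; ↭-refl; ↭-sym; ↭-trans; ↭-reflexive; ↭⇒↭ₛ)
open import Data.List.Relation.Binary.Permutation.Propositional.Properties
  using (∈-resp-↭; drop-∷; map⁺; ↭-length)
open import Data.List.Relation.Binary.Pointwise using (Pointwise-≡⇒≡)
open import Data.List.Relation.Unary.Sorted.TotalOrder.Properties using (↗↭↗⇒≋)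
open import Data.Nat using (ℕ; pred)
import Data.Nat as ℕ
import Data.Nat.Properties as ℕₚ
open import Data.List.Sort.MergeSort ℕₚ.≤-decTotalOrder using (sort)
open import Data.List.Sort.MergeSort.Properties ℕₚ.≤-decTotalOrder using (sort-↭; sort-↗)
open import Data.Product using (Σ; _×_; _,_)
open import Data.Sum using (_⊎_; inj₁; inj₂)
open import Function using (_∘_)
open import Relation.Nullary using (yes; no)
open import Relation.Nullary.Decidable using (⌊_⌋; isYes≗does; dec-true; dec-false)
open import Relation.Binary.PropositionalEquality
  using (_≡_; _≢_; refl; sym; trans; cong; cong₂; ≢-sym; module ≡-Reasoning)

multiset-↭ : ∀ {xs ys} → xs ↭ ys → multiset xs ≡ multiset ys
multiset-↭ {xs} {ys} xs↭ys = Pointwise-≡⇒≡ (↗↭↗⇒≋ ℕₚ.≤-totalOrder (sort-↗ xs) (sort-↗ ys)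
  (↭⇒↭ₛ (↭-trans (sort-↭ xs) (↭-trans xs↭ys (↭-sym (sort-↭ ys))))))

delete : ℕ → List ℕ → List ℕ
delete a [] = []
delete a (x ∷ xs) with a ℕ.≟ x
... | yes _ = xs
... | no _ = x ∷ delete a xs

∈⇒↭-delete : ∀ {a xs} → a ∈ xs → xs ↭ a ∷ delete a xs
∈⇒↭-delete {a} {x ∷ xs} a∈ with a ℕ.≟ x
∈⇒↭-delete {a} {x ∷ xs} a∈         | yes refl = ↭-refl
∈⇒↭-delete {a} {x ∷ xs} (here a≡x) | no a≢x = ⊥-elim (a≢x a≡x)
∈⇒↭-delete {a} {x ∷ xs} (there a∈) | no _ = ↭-trans (prep x (∈⇒↭-delete a∈)) (swap x a ↭-refl)

delete-↭ : ∀ {a xs ys} → xs ↭ a ∷ ys → delete a xs ↭ ys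
delete-↭ xs↭ = drop-∷ (↭-trans (↭-sym (∈⇒↭-delete (∈-resp-↭ (↭-sym xs↭) (here refl)))) xs↭)

removeOne : ℕ → Multiset → Multiset
removeOne a m = multiset (delete a m)

removeOne-↭ : ∀ {a xs ys} → xs ↭ a ∷ ys → removeOne a (multiset xs) ≡ multiset ys
removeOne-↭ {xs = xs} xs↭ = multiset-↭ (delete-↭ (↭-trans (sort-↭ xs) xs↭))

predIf : Bool → ℕ → ℕ
predIf false k = k
predIf true k = pred k

removeOneIf : Bool → ℕ → Multiset → Multiset
removeOneIf false _ m = m
removeOneIf true a m = removeOne a m

module _ {a} {A : Set a} {p q : A → Bool} where

  filterᵇ-cong-local : ∀ {xs} → All (λ z → p z ≡ q z) xs → filterᵇ p xs ≡ filterᵇ q xs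
  filterᵇ-cong-local [] = refl
  filterᵇ-cong-local {x ∷ _} (px≡qx ∷ eqs) rewrite px≡qx with q x
  ... | true = cong (x ∷_) (filterᵇ-cong-local eqs)
  ... | false = filterᵇ-cong-local eqs

  module _ {y : A} (p≡q : ∀ z → z ≢ y → p z ≡ q z) (q[y] : q y ≡ false) where

    filterᵇ-except-false : p y ≡ false → ∀ xs → filterᵇ p xs ≡ filterᵇ q xs
    filterᵇ-except-false p[y] xs = filterᵇ-cong-local (All.universal agree xs)
      where
      -- No decidable equality on A is needed: if p z ≢ q z then neither z ≡ y nor z ≢ y.
      agree : ∀ z → p z ≡ q z
      agree z with p z Bool.≟ q z
      ... | yes pz≡qz = pz≡qz
      ... | no pz≢qz = ⊥-elim (pz≢qz (p≡q z λ { refl → pz≢qz (trans p[y] (sym q[y])) }))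

    filterᵇ-except-true : p y ≡ true → ∀ {xs} → Unique xs → y ∈ xs → filterᵇ p xs ↭ y ∷ filterᵇ q xs
    filterᵇ-except-true p[y] (y∉ ∷ _) (here refl) rewrite p[y] | q[y] =
      prep y (↭-reflexive (filterᵇ-cong-local (All.map (λ y≢z → p≡q _ (≢-sym y≢z)) y∉)))
    filterᵇ-except-true p[y] {x ∷ xs} (x∉ ∷ xs!) (there y∈) rewrite p≡q x (All.lookup x∉ y∈) with q x
    ... | true = ↭-trans (prep x (filterᵇ-except-true p[y] xs! y∈)) (swap x y ↭-refl)
    ... | false = filterᵇ-except-true p[y] xs! y∈

    length-filterᵇ-except : ∀ {xs} → Unique xs → y ∈ xs →
      length (filterᵇ q xs) ≡ predIf (p y) (length (filterᵇ p xs))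
    length-filterᵇ-except {xs} xs! y∈ with p y in p[y]
    ... | false = cong length (sym (filterᵇ-except-false p[y] xs))
    ... | true = cong pred (sym (↭-length (filterᵇ-except-true p[y] xs! y∈)))

    multiset-map-filterᵇ-except : ∀ {xs} → Unique xs → y ∈ xs → (g : A → ℕ) →
      multiset (map g (filterᵇ q xs)) ≡ removeOneIf (p y) (g y) (multiset (map g (filterᵇ p xs)))
    multiset-map-filterᵇ-except {xs} xs! y∈ g with p y in p[y]
    ... | false = cong (multiset ∘ map g) (sym (filterᵇ-except-false p[y] xs))
    ... | true = sym (removeOne-↭ (map⁺ g (filterᵇ-except-true p[y] xs! y∈)))

map-cong-filterᵇ : ∀ {a} {A : Set a} {q : A → Bool} {g h : A → ℕ} →
  (∀ z → q z ≡ true → h z ≡ g z) → ∀ xs → map h (filterᵇ q xs) ≡ map g (filterᵇ q xs)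
map-cong-filterᵇ {q = q} h≡g xs =
  map-cong-local (All.map (λ {z} → h≡g z ∘ Equivalence.to T-≡) (all-filter (T? ∘ q) xs))

≢-by : ∀ {a} {A : Set a} {f : A → Bool} {z w : A} → f z ≡ true → f w ≡ false → z ≢ w
≢-by fz≡true fw≡false refl = not-¬ fz≡true fw≡false

related : (Bool → Bool → Bool) → (G : Digraph) → Vertex G → Vertex G → Bool
related k G x z = k (arc G x z) (arc G z x)

neighbours : (Bool → Bool → Bool) → (G : Digraph) → Vertex G → List (Vertex G)
neighbours k G x = filterᵇ (related k G x) (allFin (n G))

-- isOut G x, isIn G x and isStrong G x are definitionally related k G x for these
-- three k, so neighbourhood facts are proved once for any k with k false false ≡ false.
outKind inKind strongKind : Bool → Bool → Bool
outKind xz zx = xz ∧ not zx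
inKind xz zx = zx ∧ not xz
strongKind xz zx = xz ∧ zx

-- The pair is (arc x y , arc y x) in G; the DT argument of ndqWithout is dt G y.
dtWithout : Bool × Bool → DT → DT
dtWithout (xy , yx) (a , b , c) =
  predIf (outKind xy yx) a , predIf (inKind xy yx) b , predIf (strongKind xy yx) c

ndqWithout : Bool × Bool → DT → NDQ → NDQ
ndqWithout (xy , yx) d (sdon , idon , fdin , odin , tdsn) =
  removeOneIf (outKind xy yx) (secondDeg d) sdon , removeOneIf (outKind xy yx) (inDeg d) idon ,
  removeOneIf (inKind xy yx) (firstDeg d) fdin , removeOneIf (inKind xy yx) (outDeg d) odin ,
  removeOneIf (strongKind xy yx) (thirdDeg d) tdsn

data Ends {m} (u v : Fin m) : Fin m → Fin m → Set where
  uv : Ends u v u v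
  vu : Ends u v v u

Ends-swap : ∀ {m} {u v x y : Fin m} → Ends u v x y → Ends u v y x
Ends-swap uv = vu
Ends-swap vu = uv

⌊≟⌋-refl : ∀ {m} (a : Fin m) → ⌊ a ≟ a ⌋ ≡ true
⌊≟⌋-refl a = trans (isYes≗does (a ≟ a)) (dec-true (a ≟ a) refl)

⌊≟⌋-≢ : ∀ {m} {a b : Fin m} → a ≢ b → ⌊ a ≟ b ⌋ ≡ false
⌊≟⌋-≢ {a = a} {b} a≢b = trans (isYes≗does (a ≟ b)) (dec-false (a ≟ b) a≢b)

≟∧≟-false : ∀ {m} {a b c d : Fin m} → a ≢ b ⊎ c ≢ d → ⌊ a ≟ b ⌋ ∧ ⌊ c ≟ d ⌋ ≡ false
≟∧≟-false (inj₁ a≢b) rewrite ⌊≟⌋-≢ a≢b = refl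
≟∧≟-false (inj₂ c≢d) rewrite ⌊≟⌋-≢ c≢d = ∧-zeroʳ _

module _ (G : Digraph) (u v : Vertex G) where

  deleteArcs-arc : ∀ {x y} → x ≢ u ⊎ y ≢ v → x ≢ v ⊎ y ≢ u → arc (deleteArcs G u v) x y ≡ arc G x y
  deleteArcs-arc {x} {y} ¬uv ¬vu rewrite ≟∧≟-false ¬uv | ≟∧≟-false ¬vu = ∧-identityʳ (arc G x y)

  deleteArcs-between : ∀ {x y} → Ends u v x y → arc (deleteArcs G u v) x y ≡ false
  deleteArcs-between uv rewrite ⌊≟⌋-refl u | ⌊≟⌋-refl v = ∧-zeroʳ (arc G u v)
  deleteArcs-between vu rewrite ⌊≟⌋-refl u | ⌊≟⌋-refl v
    | ∨-zeroʳ (⌊ v ≟ u ⌋ ∧ ⌊ u ≟ v ⌋) = ∧-zeroʳ (arc G v u)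

  related-deleteArcs-away : ∀ {w} → w ≢ u → w ≢ v →
    ∀ k z → related k (deleteArcs G u v) w z ≡ related k G w z
  related-deleteArcs-away w≢u w≢v k z =
    cong₂ k (deleteArcs-arc (inj₁ w≢u) (inj₁ w≢v)) (deleteArcs-arc (inj₂ w≢v) (inj₂ w≢u))

  dt-deleteArcs-away : ∀ {w} → w ≢ u → w ≢ v → dt (deleteArcs G u v) w ≡ dt G w
  dt-deleteArcs-away {w} w≢u w≢v =
    cong₂ _,_ (same outKind) (cong₂ _,_ (same inKind) (same strongKind))
    where
    same : ∀ k → length (neighbours k (deleteArcs G u v) w) ≡ length (neighbours k G w)
    same k = cong length
      (filterᵇ-cong-local (All.universal (related-deleteArcs-away w≢u w≢v k) (allFin (n G))))

  module _ (u≢v : u ≢ v) where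

    deleteArcs-from-end : ∀ {x y z} → Ends u v x y → z ≢ y → arc (deleteArcs G u v) x z ≡ arc G x z
    deleteArcs-from-end uv z≢v = deleteArcs-arc (inj₂ z≢v) (inj₁ u≢v)
    deleteArcs-from-end vu z≢u = deleteArcs-arc (inj₁ (≢-sym u≢v)) (inj₂ z≢u)

    deleteArcs-to-end : ∀ {x y z} → Ends u v x y → z ≢ y → arc (deleteArcs G u v) z x ≡ arc G z x
    deleteArcs-to-end uv z≢v = deleteArcs-arc (inj₂ u≢v) (inj₁ z≢v)
    deleteArcs-to-end vu z≢u = deleteArcs-arc (inj₁ z≢u) (inj₂ (≢-sym u≢v))

    dt-deleteArcs-off-ends : ∀ {x y z} → Ends u v x y → z ≢ x → z ≢ y →
      dt (deleteArcs G u v) z ≡ dt G z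
    dt-deleteArcs-off-ends uv z≢u z≢v = dt-deleteArcs-away z≢u z≢v
    dt-deleteArcs-off-ends vu z≢v z≢u = dt-deleteArcs-away z≢u z≢v

    module _ {x y : Vertex G} (ends : Ends u v x y)
      (k : Bool → Bool → Bool) (k-ff : k false false ≡ false) where

      related-deleteArcs-end : ∀ z → z ≢ y → related k G x z ≡ related k (deleteArcs G u v) x z
      related-deleteArcs-end z z≢y =
        sym (cong₂ k (deleteArcs-from-end ends z≢y) (deleteArcs-to-end ends z≢y))

      related-deleteArcs-partner : related k (deleteArcs G u v) x y ≡ false
      related-deleteArcs-partner
        rewrite deleteArcs-between ends | deleteArcs-between (Ends-swap ends) = k-ff

      related-deleteArcs-self : related k (deleteArcs G u v) x x ≡ false
      related-deleteArcs-self rewrite loopless (deleteArcs G u v) x = k-ff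

      length-neighbours-deleteArcs-end :
        length (neighbours k (deleteArcs G u v) x) ≡ predIf (related k G x y) (length (neighbours k G x))
      length-neighbours-deleteArcs-end = length-filterᵇ-except related-deleteArcs-end
        related-deleteArcs-partner (allFin⁺ (n G)) (∈-allFin y)

      multiset-neighbours-deleteArcs-end : (f : DT → ℕ) →
        multiset (map (f ∘ dt (deleteArcs G u v)) (neighbours k (deleteArcs G u v) x))
          ≡ removeOneIf (related k G x y) (f (dt G y)) (multiset (map (f ∘ dt G) (neighbours k G x)))
      multiset-neighbours-deleteArcs-end f = trans
        (cong multiset (map-cong-filterᵇ unchanged (allFin (n G))))
        (multiset-map-filterᵇ-except related-deleteArcs-end related-deleteArcs-partner
          (allFin⁺ (n G)) (∈-allFin y) (f ∘ dt G))
        where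
        unchanged : ∀ z → related k (deleteArcs G u v) x z ≡ true →
          f (dt (deleteArcs G u v) z) ≡ f (dt G z)
        unchanged z xz = cong f (dt-deleteArcs-off-ends ends (≢-by xz related-deleteArcs-self)
          (≢-by xz related-deleteArcs-partner))

    dt-deleteArcs-end : ∀ {x y} → Ends u v x y →
      dt (deleteArcs G u v) x ≡ dtWithout (arc G x y , arc G y x) (dt G x)
    dt-deleteArcs-end ends = cong₂ _,_ (length-neighbours-deleteArcs-end ends outKind refl)
      (cong₂ _,_ (length-neighbours-deleteArcs-end ends inKind refl)
                 (length-neighbours-deleteArcs-end ends strongKind refl))

    ndq-deleteArcs-end : ∀ {x y} → Ends u v x y →
      ndq (deleteArcs G u v) x ≡ ndqWithout (arc G x y , arc G y x) (dt G y) (ndq G x)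
    ndq-deleteArcs-end ends = cong₂ _,_ (out secondDeg) (cong₂ _,_ (out inDeg)
      (cong₂ _,_ (in′ firstDeg) (cong₂ _,_ (in′ outDeg)
        (multiset-neighbours-deleteArcs-end ends strongKind refl thirdDeg))))
      where
      out = multiset-neighbours-deleteArcs-end ends outKind refl
      in′ = multiset-neighbours-deleteArcs-end ends inKind refl

arcPair : ArcSet → Bool × Bool
arcPair noArc = false , false
arcPair onlyUV = true , false
arcPair onlyVU = false , true
arcPair bothArcs = true , true

arcPair-arcsBetween : (G : Digraph) (u v : Vertex G) →
  arcPair (arcsBetween G u v) ≡ (arc G u v , arc G v u)
arcPair-arcsBetween G u v with arc G u v | arc G v u
... | false | false = refl
... | true  | false = refl
... | false | true  = refl
... | true  | true  = refl

afterDeleting : Bool × Bool → DT → DT → NDQ → NDQ → DT × DT × NDQ × NDQ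
afterDeleting (a , b) du dv nu nv =
  dtWithout (a , b) du , dtWithout (b , a) dv , ndqWithout (a , b) dv nu , ndqWithout (b , a) du nv

lemma4p13 : Σ (ArcSet → DT → DT → NDQ → NDQ → DT × DT × NDQ × NDQ) λ F →
    (G : Digraph) (u v : Vertex G) → u ≢ v →
    (dt (deleteArcs G u v) u , dt (deleteArcs G u v) v ,
     ndq (deleteArcs G u v) u , ndq (deleteArcs G u v) v)
      ≡ F (arcsBetween G u v) (dt G u) (dt G v) (ndq G u) (ndq G v)
lemma4p13 = afterDeleting ∘ arcPair , λ G u v u≢v → begin
    (dt (deleteArcs G u v) u , dt (deleteArcs G u v) v ,
     ndq (deleteArcs G u v) u , ndq (deleteArcs G u v) v)
  ≡⟨ cong₂ _,_ (dt-deleteArcs-end G u v u≢v uv) (cong₂ _,_ (dt-deleteArcs-end G u v u≢v vu)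
      (cong₂ _,_ (ndq-deleteArcs-end G u v u≢v uv) (ndq-deleteArcs-end G u v u≢v vu))) ⟩
    afterDeleting (arc G u v , arc G v u) (dt G u) (dt G v) (ndq G u) (ndq G v)
  ≡⟨ cong (λ t → afterDeleting t (dt G u) (dt G v) (ndq G u) (ndq G v))
       (sym (arcPair-arcsBetween G u v)) ⟩
    afterDeleting (arcPair (arcsBetween G u v)) (dt G u) (dt G v) (ndq G u) (ndq G v)
  ∎
  where open ≡-Reasoning
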